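{- Define $k_1 = 1$ and, for $n \geq 2$, $k_n = \lfloor n/2\rfloor + k_{\lfloor n/2\rfloor} + k_{\lfloor (n+1)/2\rfloor}$. For every $n \in \mathbb{N}$ there is a subset of $\mathrm{Fn}(k_n,2)$ that is $I(n+1)$-bounding.
   Context: $\mathrm{Fn}(k,2)$ is the set of all functions from a subset of $\{1,\dots,k\}$ to $\{p,n\}$. $\mathcal{F}\subseteq\mathrm{Fn}(k,2)$ is full if for every $i\in\{1,\dots,k\}$ and $j\in\{p,n\}$ some $f\in\mathcal{F}$ has $f(i)=j$. For $m\in\mathbb{N}$, a family $\mathcal{F}\subseteq\mathrm{Fn}(k,2)$ is $I(m)$-bounding if it is full and for every $\mathcal{G}\subseteq\mathcal{F}$ and every $D\subseteq\bigcup_{g\in\mathcal{G}}\mathrm{dom}(g)$ with $|D|\geq m$, there are two functions in $\mathcal{G}$ that disagree at some point of $D$ (i.e. $g,g'\in\mathcal{G}$ and $d\in D$ with $g(d),g'(d)$ both defined and different). -}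

module Defs where

open import Data.Nat using (ℕ; _≤_)
open import Data.Bool using (Bool; true; false)
open import Data.Maybe using (Maybe; just; nothing)
open import Data.Fin using (Fin)
open import Data.Vec using (Vec; lookup)
open import Data.List using (List)
open import Data.List.Membership.Propositional as L using ()
open import Data.Fin.Subset as S using (Subset; ∣_∣)
open import Data.Product using (Σ; ∃; _×_)
open import Relation.Binary.PropositionalEquality using (_≡_; _≢_)

-- The two values p and n are encoded as Bool: p = true, n = false.
-- An element of Fn(k,2) (a partial function from {1,…,k} to {p,n}) is a
-- vector of length k whose i-th entry is 'nothing' if i ∉ dom f and
-- 'just b' if f(i) = b.  (Fin k ≅ {1,…,k}.)
Fn : ℕ → Set
Fn k = Vec (Maybe Bool) k

_∈dom_ : ∀ {k} → Fin k → Fn k → Set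
i ∈dom f = Σ Bool λ b → lookup f i ≡ just b

Family : ℕ → Set
Family k = List (Fn k)

Full : ∀ {k} → Family k → Set
Full {k} F = (i : Fin k) (j : Bool) → Σ (Fn k) λ f → f L.∈ F × lookup f i ≡ just j

DisagreeAt : ∀ {k} → Fn k → Fn k → Fin k → Set
DisagreeAt g g' d = Σ Bool λ b → Σ Bool λ b' →
  lookup g d ≡ just b × lookup g' d ≡ just b' × b ≢ b'

IBounding : ∀ {k} → ℕ → Family k → Set
IBounding {k} m F =
  Full F ×
  ((G : Family k) → (∀ g → g L.∈ G → g L.∈ F) →
   (D : Subset k) → (∀ d → d S.∈ D → Σ (Fn k) λ g → g L.∈ G × d ∈dom g) →
   m ≤ ∣ D ∣ →
   Σ (Fn k) λ g → Σ (Fn k) λ g' → Σ (Fin k) λ d →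
     g L.∈ G × g' L.∈ G × d S.∈ D × DisagreeAt g g' d)

-- Two I(m₁+1)- and I(m₂+1)-bounding families F₁, F₂ (on k₁ and k₂ points)
-- combine into an I(m₁+m₂+1)-bounding family on a + k₁ + k₂ points, for any
-- a ≤ m₁, m₂: put F₁ and F₂ on disjoint blocks and extend every member of F₁
-- by p, every member of F₂ by n, on a new "switch" block of size a.  A set D
-- of more than m₁ + m₂ covered points either has more than m₁ points in the
-- first block or more than m₂ in the second, where F₁ resp. F₂ produces a
-- disagreement; or it meets the switch block as well as both other blocks,
-- and then a function covering a point of the first block disagrees on the
-- switch block with one covering a point of the second.  Splitting n into
-- ⌊n/2⌋ + ⌈n/2⌉ and taking a = ⌊n/2⌋ yields the recursion for kₙ.
module Submission where

open import Defs
open import Data.Nat using (ℕ; zero; suc; _+_; _≤_; _<_; z≤n; s≤s; z<s; ⌊_/2⌋; ⌈_/2⌉)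
open import Data.Nat.Properties
open import Data.Nat.Induction using (<-rec)
open import Data.Product using (Σ; _,_; _×_; proj₁; proj₂)
open import Data.Sum using (inj₁; inj₂)
open import Data.Bool using (true; false)
open import Data.Maybe using (just; nothing)
open import Data.Fin using (Fin; zero; suc; _↑ˡ_; _↑ʳ_)
open import Data.Vec using (Vec; []; _∷_; lookup; _++_; replicate; tabulate; splitAt)
open import Data.Vec.Properties using (lookup-++ˡ; lookup-++ʳ; lookup-replicate; lookup∘tabulate; tabulate∘lookup; tabulate-cong; []=⇒lookup; lookup⇒[]=)
open import Data.List using (map) renaming (_∷_ to _∷ᴸ_; [] to []ᴸ; _++_ to _++ᴸ_)
open import Data.List.Membership.Propositional using (_∈_)
open import Data.List.Membership.Propositional.Properties using (∈-map⁺; ∈-map⁻)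
import Data.List.Membership.Propositional.Properties as List
open import Data.List.Relation.Unary.Any using (here; there)
open import Data.Fin.Subset as S using (Subset; ∣_∣; Nonempty)
open import Data.Fin.Subset.Properties using (∣p∣≤n; nonempty?; Empty-unique; ∣⊥∣≡0)
open import Function using (_∘_)
open import Relation.Nullary using (yes; no; contradiction)
open import Relation.Binary.PropositionalEquality using (_≡_; refl; sym; trans; cong; subst; subst₂)

private
  variable
    A : Set
    k K m n : ℕ

emptyFn : ∀ k → Fn k
emptyFn k = replicate k nothing

_⊆ᶠ_ : Family k → Family k → Set
G ⊆ᶠ F = ∀ g → g ∈ G → g ∈ F

_Covers_ : Family k → Subset k → Set
_Covers_ {k} G D = ∀ d → d S.∈ D → Σ (Fn k) λ g → g ∈ G × d ∈dom g

DisagreeOn : Family k → Subset k → Set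
DisagreeOn {k} G D = Σ (Fn k) λ g → Σ (Fn k) λ g' → Σ (Fin k) λ d →
  g ∈ G × g' ∈ G × d S.∈ D × DisagreeAt g g' d

Bounds : ℕ → Family k → Set
Bounds {k} m F = (G : Family k) → G ⊆ᶠ F → (D : Subset k) → G Covers D → m ≤ ∣ D ∣ → DisagreeOn G D

-- Restricting a member of the combined family to a block on which it is
-- undefined gives the empty function, so the recursion keeps it in every family.
BoundingWithEmpty : ℕ → ℕ → Set
BoundingWithEmpty k m = Σ (Family k) λ F → emptyFn k ∈ F × IBounding (suc m) F

∣p++q∣≡∣p∣+∣q∣ : (p : Subset m) (q : Subset n) → ∣ p ++ q ∣ ≡ ∣ p ∣ + ∣ q ∣
∣p++q∣≡∣p∣+∣q∣ []          q = refl
∣p++q∣≡∣p∣+∣q∣ (true ∷ p)  q = cong suc (∣p++q∣≡∣p∣+∣q∣ p q)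
∣p++q∣≡∣p∣+∣q∣ (false ∷ p) q = ∣p++q∣≡∣p∣+∣q∣ p q

∣p∣>0⇒Nonempty : (p : Subset n) → 0 < ∣ p ∣ → Nonempty p
∣p∣>0⇒Nonempty {n} p ∣p∣>0 with nonempty? p
... | yes p≢∅ = p≢∅
... | no  p≡∅ = contradiction (trans (cong ∣_∣ (Empty-unique p≡∅)) (∣⊥∣≡0 n)) (>⇒≢ ∣p∣>0)

∈-lookup : ∀ {D : Subset m} {E : Subset n} {i j} → lookup D i ≡ lookup E j → j S.∈ E → i S.∈ D
∈-lookup D[i]≡E[j] j∈E = lookup⇒[]= _ _ (trans D[i]≡E[j] ([]=⇒lookup j∈E))

restrict : (Fin k → Fin K) → Fn K → Fn k
restrict ι g = tabulate (lookup g ∘ ι)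

restrict-≗ : ∀ (ι : Fin k → Fin K) {g f} → (∀ x → lookup g (ι x) ≡ lookup f x) → restrict ι g ≡ f
restrict-≗ ι {f = f} g∘ι≗f = trans (tabulate-cong g∘ι≗f) (tabulate∘lookup f)

lookup-emptyFn : ∀ i → lookup (emptyFn k) i ≡ nothing
lookup-emptyFn i = lookup-replicate i nothing

restrict-emptyFn : ∀ (ι : Fin k → Fin K) {g} → (∀ x → lookup g (ι x) ≡ nothing) → restrict ι g ≡ emptyFn k
restrict-emptyFn ι {g} g∘ι≗∅ = restrict-≗ ι {g} λ x → trans (g∘ι≗∅ x) (sym (lookup-emptyFn x))

disagreeOn-restrict : ∀ (ι : Fin k → Fin K) {F₁ : Family k} {F G : Family K} {D : Subset K} →
  Bounds m F₁ → (∀ g → g ∈ F → restrict ι g ∈ F₁) → G ⊆ᶠ F → G Covers D →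
  (E : Subset k) → (∀ x → x S.∈ E → ι x S.∈ D) → m ≤ ∣ E ∣ → DisagreeOn G D
disagreeOn-restrict ι {F₁} {G = G} bounds restrict∈ G⊆F covers E ι[E]⊆D m≤∣E∣
  with bounds (map (restrict ι) G) restricted⊆F₁ E restrictedCovers m≤∣E∣
  where
  restricted⊆F₁ : map (restrict ι) G ⊆ᶠ F₁
  restricted⊆F₁ _ h∈ with ∈-map⁻ (restrict ι) h∈
  ... | g , g∈G , refl = restrict∈ g (G⊆F g g∈G)
  restrictedCovers : map (restrict ι) G Covers E
  restrictedCovers x x∈E with covers (ι x) (ι[E]⊆D x x∈E)
  ... | g , g∈G , b , g[ιx]≡b = restrict ι g , ∈-map⁺ (restrict ι) g∈G , b ,
                                trans (lookup∘tabulate _ x) g[ιx]≡b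
... | h , h' , x , h∈ , h'∈ , x∈E , b , b' , h[x]≡b , h'[x]≡b' , b≢b'
  with ∈-map⁻ (restrict ι) h∈ | ∈-map⁻ (restrict ι) h'∈
... | g , g∈G , refl | g' , g'∈G , refl =
  g , g' , ι x , g∈G , g'∈G , ι[E]⊆D x x∈E , b , b' ,
  trans (sym (lookup∘tabulate _ x)) h[x]≡b , trans (sym (lookup∘tabulate _ x)) h'[x]≡b' , b≢b'

data Split (m n : ℕ) : Fin (m + n) → Set where
  inˡ : (i : Fin m) → Split m n (i ↑ˡ n)
  inʳ : (j : Fin n) → Split m n (m ↑ʳ j)

split : ∀ m n (i : Fin (m + n)) → Split m n i
split zero    n i       = inʳ i
split (suc m) n zero    = inˡ zero
split (suc m) n (suc i) with split m n i
... | inˡ i' = inˡ (suc i')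
... | inʳ j  = inʳ j

module Blocks (a k₁ k₂ : ℕ) where

  switchCoord : Fin a → Fin (a + k₁ + k₂)
  switchCoord s = (s ↑ˡ k₁) ↑ˡ k₂

  leftCoord : Fin k₁ → Fin (a + k₁ + k₂)
  leftCoord x = (a ↑ʳ x) ↑ˡ k₂

  rightCoord : Fin k₂ → Fin (a + k₁ + k₂)
  rightCoord y = (a + k₁) ↑ʳ y

  blocks : Vec A a → Vec A k₁ → Vec A k₂ → Vec A (a + k₁ + k₂)
  blocks u v w = (u ++ v) ++ w

  lookup-switch : ∀ (u : Vec A a) v w s → lookup (blocks u v w) (switchCoord s) ≡ lookup u s
  lookup-switch u v w s = trans (lookup-++ˡ (u ++ v) w (s ↑ˡ k₁)) (lookup-++ˡ u v s)

  lookup-left : ∀ (u : Vec A a) v w x → lookup (blocks u v w) (leftCoord x) ≡ lookup v x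
  lookup-left u v w x = trans (lookup-++ˡ (u ++ v) w (a ↑ʳ x)) (lookup-++ʳ u v x)

  lookup-right : ∀ (u : Vec A a) v w y → lookup (blocks u v w) (rightCoord y) ≡ lookup w y
  lookup-right u v w y = lookup-++ʳ (u ++ v) w y

  ∣blocks∣ : ∀ (Ds : Subset a) Dx Dy → ∣ blocks Ds Dx Dy ∣ ≡ ∣ Ds ∣ + ∣ Dx ∣ + ∣ Dy ∣
  ∣blocks∣ Ds Dx Dy = trans (∣p++q∣≡∣p∣+∣q∣ (Ds ++ Dx) Dy) (cong (_+ ∣ Dy ∣) (∣p++q∣≡∣p∣+∣q∣ Ds Dx))

all-parts-positive : ∀ {s x y m₁ m₂} → s ≤ m₁ → s ≤ m₂ → x ≤ m₁ → y ≤ m₂ →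
  m₁ + m₂ < s + x + y → 0 < s × 0 < x × 0 < y
all-parts-positive {zero} _ _ x≤m₁ y≤m₂ big = contradiction big (≤⇒≯ (+-mono-≤ x≤m₁ y≤m₂))
all-parts-positive {s} {zero} s≤m₁ _ _ y≤m₂ big =
  contradiction big (≤⇒≯ (+-mono-≤ (≤-trans (≤-reflexive (+-identityʳ s)) s≤m₁) y≤m₂))
all-parts-positive {s} {x} {zero} {m₁} {m₂} _ s≤m₂ x≤m₁ _ big = contradiction big (≤⇒≯ (begin
  s + x + 0 ≡⟨ +-identityʳ (s + x) ⟩
  s + x     ≤⟨ +-mono-≤ s≤m₂ x≤m₁ ⟩
  m₂ + m₁   ≡⟨ +-comm m₂ m₁ ⟩
  m₁ + m₂   ∎))
  where open ≤-Reasoning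
all-parts-positive {suc _} {suc _} {suc _} _ _ _ _ _ = z<s , z<s , z<s

module Combine {a m₁ m₂ k₁ k₂ : ℕ} (a≤m₁ : a ≤ m₁) (a≤m₂ : a ≤ m₂)
               (W₁ : BoundingWithEmpty k₁ m₁) (W₂ : BoundingWithEmpty k₂ m₂) where

  open Blocks a k₁ k₂

  F₁ : Family k₁
  F₁ = proj₁ W₁

  F₂ : Family k₂
  F₂ = proj₁ W₂

  ∅∈F₁ : emptyFn k₁ ∈ F₁
  ∅∈F₁ = proj₁ (proj₂ W₁)

  ∅∈F₂ : emptyFn k₂ ∈ F₂
  ∅∈F₂ = proj₁ (proj₂ W₂)

  full₁ : Full F₁
  full₁ = proj₁ (proj₂ (proj₂ W₁))

  full₂ : Full F₂
  full₂ = proj₁ (proj₂ (proj₂ W₂))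

  bounds₁ : Bounds (suc m₁) F₁
  bounds₁ = proj₂ (proj₂ (proj₂ W₁))

  bounds₂ : Bounds (suc m₂) F₂
  bounds₂ = proj₂ (proj₂ (proj₂ W₂))

  extendLeft : Fn k₁ → Fn (a + k₁ + k₂)
  extendLeft f = blocks (replicate a (just true)) f (emptyFn k₂)

  extendRight : Fn k₂ → Fn (a + k₁ + k₂)
  extendRight g = blocks (replicate a (just false)) (emptyFn k₁) g

  extendLeft-switch : ∀ f s → lookup (extendLeft f) (switchCoord s) ≡ just true
  extendLeft-switch f s = trans (lookup-switch (replicate a (just true)) f (emptyFn k₂) s) (lookup-replicate s _)

  extendLeft-left : ∀ f x → lookup (extendLeft f) (leftCoord x) ≡ lookup f x
  extendLeft-left f = lookup-left (replicate a (just true)) f (emptyFn k₂)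

  extendLeft-right : ∀ f y → lookup (extendLeft f) (rightCoord y) ≡ nothing
  extendLeft-right f y = trans (lookup-right (replicate a (just true)) f (emptyFn k₂) y) (lookup-emptyFn y)

  extendRight-switch : ∀ g s → lookup (extendRight g) (switchCoord s) ≡ just false
  extendRight-switch g s = trans (lookup-switch (replicate a (just false)) (emptyFn k₁) g s) (lookup-replicate s _)

  extendRight-right : ∀ g y → lookup (extendRight g) (rightCoord y) ≡ lookup g y
  extendRight-right g = lookup-right (replicate a (just false)) (emptyFn k₁) g

  extendRight-left : ∀ g x → lookup (extendRight g) (leftCoord x) ≡ nothing
  extendRight-left g x = trans (lookup-left (replicate a (just false)) (emptyFn k₁) g x) (lookup-emptyFn x)

  F : Family (a + k₁ + k₂)
  F = emptyFn _ ∷ᴸ (map extendLeft F₁ ++ᴸ map extendRight F₂)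

  extendLeft∈ : ∀ {f} → f ∈ F₁ → extendLeft f ∈ F
  extendLeft∈ f∈ = there (List.∈-++⁺ˡ (∈-map⁺ extendLeft f∈))

  extendRight∈ : ∀ {g} → g ∈ F₂ → extendRight g ∈ F
  extendRight∈ g∈ = there (List.∈-++⁺ʳ (map extendLeft F₁) (∈-map⁺ extendRight g∈))

  data Origin : Fn (a + k₁ + k₂) → Set where
    empty : Origin (emptyFn _)
    left  : ∀ {f} → f ∈ F₁ → Origin (extendLeft f)
    right : ∀ {g} → g ∈ F₂ → Origin (extendRight g)

  origin : ∀ {g} → g ∈ F → Origin g
  origin (here refl) = empty
  origin (there g∈) with List.∈-++⁻ (map extendLeft F₁) g∈
  ... | inj₁ g∈ˡ with ∈-map⁻ extendLeft g∈ˡ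
  ...   | _ , f∈ , refl = left f∈
  origin (there g∈) | inj₂ g∈ʳ with ∈-map⁻ extendRight g∈ʳ
  ...   | _ , f∈ , refl = right f∈

  restrict-left∈ : ∀ g → g ∈ F → restrict leftCoord g ∈ F₁
  restrict-left∈ g g∈ with origin g∈
  ... | empty       = subst (_∈ F₁) (sym (restrict-emptyFn leftCoord {emptyFn _} (lookup-emptyFn ∘ leftCoord))) ∅∈F₁
  ... | left {f} f∈ = subst (_∈ F₁) (sym (restrict-≗ leftCoord {extendLeft f} (extendLeft-left f))) f∈
  ... | right {h} _ = subst (_∈ F₁) (sym (restrict-emptyFn leftCoord {extendRight h} (extendRight-left h))) ∅∈F₁

  restrict-right∈ : ∀ g → g ∈ F → restrict rightCoord g ∈ F₂
  restrict-right∈ g g∈ with origin g∈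
  ... | empty        = subst (_∈ F₂) (sym (restrict-emptyFn rightCoord {emptyFn _} (lookup-emptyFn ∘ rightCoord))) ∅∈F₂
  ... | left {f} _   = subst (_∈ F₂) (sym (restrict-emptyFn rightCoord {extendLeft f} (extendLeft-right f))) ∅∈F₂
  ... | right {h} h∈ = subst (_∈ F₂) (sym (restrict-≗ rightCoord {extendRight h} (extendRight-right h))) h∈

  switch-true : ∀ {g x} → g ∈ F → leftCoord x ∈dom g → ∀ s → lookup g (switchCoord s) ≡ just true
  switch-true {x = x} g∈ (b , g[x]≡b) s with origin g∈
  ... | empty       = contradiction (trans (sym (lookup-emptyFn (leftCoord x))) g[x]≡b) λ ()
  ... | left {f} _  = extendLeft-switch f s
  ... | right {h} _ = contradiction (trans (sym (extendRight-left h x)) g[x]≡b) λ ()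

  switch-false : ∀ {g y} → g ∈ F → rightCoord y ∈dom g → ∀ s → lookup g (switchCoord s) ≡ just false
  switch-false {y = y} g∈ (b , g[y]≡b) s with origin g∈
  ... | empty       = contradiction (trans (sym (lookup-emptyFn (rightCoord y))) g[y]≡b) λ ()
  ... | left {f} _  = contradiction (trans (sym (extendLeft-right f y)) g[y]≡b) λ ()
  ... | right {h} _ = extendRight-switch h s

  full : Full F
  full i j with split (a + k₁) k₂ i
  full _ j | inʳ y with full₂ y j
  ... | g , g∈ , g[y]≡j = extendRight g , extendRight∈ g∈ , trans (extendRight-right g y) g[y]≡j
  full _ j | inˡ i with split a k₁ i
  full _ j | inˡ _ | inʳ x with full₁ x j
  ... | f , f∈ , f[x]≡j = extendLeft f , extendLeft∈ f∈ , trans (extendLeft-left f x) f[x]≡j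
  full _ true  | inˡ _ | inˡ s = extendLeft (emptyFn k₁) , extendLeft∈ ∅∈F₁ ,
                                 extendLeft-switch (emptyFn k₁) s
  full _ false | inˡ _ | inˡ s = extendRight (emptyFn k₂) , extendRight∈ ∅∈F₂ ,
                                 extendRight-switch (emptyFn k₂) s

  bounds-blocks : (G : Family (a + k₁ + k₂)) → G ⊆ᶠ F → (Ds : Subset a) (Dx : Subset k₁) (Dy : Subset k₂) →
    G Covers blocks Ds Dx Dy → suc (m₁ + m₂) ≤ ∣ blocks Ds Dx Dy ∣ → DisagreeOn G (blocks Ds Dx Dy)
  bounds-blocks G G⊆F Ds Dx Dy covers big with m₁ <? ∣ Dx ∣ | m₂ <? ∣ Dy ∣
  ... | yes m₁<∣Dx∣ | _ = disagreeOn-restrict leftCoord bounds₁ restrict-left∈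
      G⊆F covers Dx (λ x → ∈-lookup (lookup-left Ds Dx Dy x)) m₁<∣Dx∣
  ... | no _ | yes m₂<∣Dy∣ = disagreeOn-restrict rightCoord bounds₂ restrict-right∈
      G⊆F covers Dy (λ y → ∈-lookup (lookup-right Ds Dx Dy y)) m₂<∣Dy∣
  ... | no m₁≮∣Dx∣ | no m₂≮∣Dy∣
    with all-parts-positive (≤-trans (∣p∣≤n Ds) a≤m₁) (≤-trans (∣p∣≤n Ds) a≤m₂)
           (≮⇒≥ m₁≮∣Dx∣) (≮⇒≥ m₂≮∣Dy∣) (subst (m₁ + m₂ <_) (∣blocks∣ Ds Dx Dy) big)
  ... | ∣Ds∣>0 , ∣Dx∣>0 , ∣Dy∣>0
    with ∣p∣>0⇒Nonempty Ds ∣Ds∣>0 | ∣p∣>0⇒Nonempty Dx ∣Dx∣>0 | ∣p∣>0⇒Nonempty Dy ∣Dy∣>0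
  ... | s , s∈ | x , x∈ | y , y∈
    with covers (leftCoord x) (∈-lookup (lookup-left Ds Dx Dy x) x∈)
       | covers (rightCoord y) (∈-lookup (lookup-right Ds Dx Dy y) y∈)
  ... | g , g∈G , x∈dom | g' , g'∈G , y∈dom =
    g , g' , switchCoord s , g∈G , g'∈G , ∈-lookup (lookup-switch Ds Dx Dy s) s∈ , true , false ,
    switch-true (G⊆F g g∈G) x∈dom s , switch-false (G⊆F g' g'∈G) y∈dom s , λ ()

  bounds : Bounds (suc (m₁ + m₂)) F
  bounds G G⊆F D covers big with splitAt (a + k₁) D
  ... | Dsx , Dy , refl with splitAt a Dsx
  ... | Ds , Dx , refl = bounds-blocks G G⊆F Ds Dx Dy covers big

  combined : BoundingWithEmpty (a + k₁ + k₂) (m₁ + m₂)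
  combined = F , here refl , full , bounds

boundingWithEmpty-1 : BoundingWithEmpty 1 1
boundingWithEmpty-1 = emptyFn 1 ∷ᴸ (just true ∷ []) ∷ᴸ (just false ∷ []) ∷ᴸ []ᴸ , here refl , full ,
                      λ _ _ D _ big → contradiction big (<⇒≱ (s≤s (∣p∣≤n D)))
  where
  full : Full _
  full zero true  = _ , there (here refl) , refl
  full zero false = _ , there (there (here refl)) , refl

module Recursion (kseq : ℕ → ℕ) (kseq-1 : kseq 1 ≡ 1)
  (kseq-rec : ∀ n → 2 ≤ n → kseq n ≡ ⌊ n /2⌋ + kseq ⌊ n /2⌋ + kseq ⌊ (n + 1) /2⌋) where

  kseq-halves : ∀ n → 2 ≤ n → kseq n ≡ ⌊ n /2⌋ + kseq ⌊ n /2⌋ + kseq ⌈ n /2⌉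
  kseq-halves n 2≤n = trans (kseq-rec n 2≤n) (cong (λ t → ⌊ n /2⌋ + kseq ⌊ n /2⌋ + kseq ⌊ t /2⌋) (+-comm n 1))

  boundingWithEmpty : ∀ n → 1 ≤ n → BoundingWithEmpty (kseq n) n
  boundingWithEmpty = <-rec _ step
    where
    step : ∀ n → (∀ {m} → m < n → 1 ≤ m → BoundingWithEmpty (kseq m) m) → 1 ≤ n → BoundingWithEmpty (kseq n) n
    step 1 _ _ = subst (λ k → BoundingWithEmpty k 1) (sym kseq-1) boundingWithEmpty-1
    step n@(suc (suc n')) rec _ =
      subst₂ BoundingWithEmpty (sym (kseq-halves n (s≤s (s≤s z≤n)))) (⌊n/2⌋+⌈n/2⌉≡n n)
        (Combine.combined ≤-refl (⌊n/2⌋≤⌈n/2⌉ n)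
          (rec (⌊n/2⌋<n (suc n')) (s≤s z≤n)) (rec (⌈n/2⌉<n n') (s≤s z≤n)))

mainTheorem9 : (kseq : ℕ → ℕ) →
               kseq 1 ≡ 1 →
               (∀ n → 2 ≤ n → kseq n ≡ ⌊ n /2⌋ + kseq ⌊ n /2⌋ + kseq ⌊ (n + 1) /2⌋) →
               (n : ℕ) → 1 ≤ n →
               Σ (Family (kseq n)) λ F → IBounding (n + 1) F
mainTheorem9 kseq kseq-1 kseq-rec n 1≤n with Recursion.boundingWithEmpty kseq kseq-1 kseq-rec n 1≤n
... | F , _ , bounding = F , subst (λ m → IBounding m F) (+-comm 1 n) bounding
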